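{- If the triple $(a,b,c)$ of positive integers is good and $a=b+c$, then $b$ and $c$ are relatively prime.
   Context: For positive integers $a,b,c$ with $n=a+b+c$, the permutation of the triple $(a,b,c)$ is the permutation of $[n]$ with $p_i=n+1-i$ for $1\le i\le a$, $p_i=a+b+1-i$ for $a+1\le i\le a+b$, and $p_i=n+b+1-i$ for $a+b+1\le i\le n$ (one-line notation $n\cdots(n-a+1)\ b\cdots1\ (b+c)\cdots(b+1)$). The triple is good if this permutation, as a bijection $i\mapsto p_i$ of $[n]$, is a single $n$-cycle. -}

module Defs where

open import Data.Nat using (ℕ; zero; suc; _+_; _∸_; _≤_)
open import Data.Nat.Properties using (_≤?_)
open import Data.Product using (_×_; ∃)
open import Relation.Binary.PropositionalEquality using (_≡_)
open import Relation.Nullary using (yes; no)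

-- The permutation of the triple (a,b,c), n = a+b+c, as a map on ℕ
-- (only its values on [n] = {1,…,n} matter):
--   p i = n+1-i      for 1 ≤ i ≤ a
--   p i = a+b+1-i    for a+1 ≤ i ≤ a+b
--   p i = n+b+1-i    for a+b+1 ≤ i ≤ n
tripleMap : ℕ → ℕ → ℕ → ℕ → ℕ
tripleMap a b c i with i ≤? a
... | yes _ = suc (a + b + c) ∸ i
... | no _ with i ≤? a + b
...   | yes _ = suc (a + b) ∸ i
...   | no _  = suc (a + b + c + b) ∸ i

iter : (ℕ → ℕ) → ℕ → ℕ → ℕ
iter f zero x = x
iter f (suc k) x = f (iter f k x)

-- A permutation p of [n] = {1,…,n} is a single n-cycle iff it has exactly
-- one orbit on [n]: every j ∈ [n] is reached from every i ∈ [n].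
IsSingleCycle : ℕ → (ℕ → ℕ) → Set
IsSingleCycle n p =
  ∀ i j → 1 ≤ i → i ≤ n → 1 ≤ j → j ≤ n → ∃ λ k → iter p k i ≡ j

Good : ℕ → ℕ → ℕ → Set
Good a b c = IsSingleCycle (a + b + c) (tripleMap a b c)

module Submission where

-- Let n = a + b + c with a = b + c (so n = 2a) and let p be the
-- permutation of the triple.  Fold [1,n] onto [1,a] by reflecting the upper
-- half, x ↦ n + 1 - x for x > a.  A direct case analysis on the three pieces
-- of p shows that one step of p changes the folded position by 0, by -c or
-- by +b (p² acts on the lower half as the rotation x ↦ x + b mod a).
-- Hence if d divides both b and c, the folded position modulo d is
-- invariant along every orbit of p.  Since p maps [1,n] into itself, the
-- orbit of 1 stays in [1,n]; the triple being good, it reaches 2 ≤ a.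
-- Comparing folded positions gives 2 ≡ 1 (mod d), i.e. d = 1.

open import Defs
open import Data.Nat using (ℕ; _+_; _≤_)
open import Data.Nat.Coprimality using (Coprime)
open import Relation.Binary.PropositionalEquality using (_≡_)

open import Data.Nat using (zero; suc; _∸_; _<_; s≤s; z≤n; NonZero; _%_)
open import Data.Nat.Properties
open import Data.Nat.DivMod using ([m+kn]%n≡m%n)
open import Data.Nat.Divisibility using (_∣_; divides; 0∣⇒≡0)
open import Data.Product using (_×_; _,_; ∃; proj₁; proj₂)
open import Data.Sum using (_⊎_; inj₁; inj₂)
open import Data.Empty using (⊥-elim)
open import Relation.Nullary using (yes; no)
open import Relation.Binary.PropositionalEquality using (refl; sym; trans; cong; subst; module ≡-Reasoning)

reflect-pos : ∀ {x m} → x ≤ m → 1 ≤ suc m ∸ x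
reflect-pos z≤n = s≤s z≤n
reflect-pos (s≤s x≤m) = reflect-pos x≤m

reflect-≤ : ∀ {x} m → 1 ≤ x → suc m ∸ x ≤ m
reflect-≤ {suc x} m _ = m∸n≤m m x

iter-preserves : ∀ {P : ℕ → Set} (f : ℕ → ℕ) → (∀ x → P x → P (f x)) →
                 ∀ k x → P x → P (iter f k x)
iter-preserves f step zero    x px = px
iter-preserves f step (suc k) x px = step _ (iter-preserves f step k x px)

InRange : ℕ → ℕ → Set
InRange n x = 1 ≤ x × x ≤ n

module Triple (a b c : ℕ) where

  n : ℕ
  n = a + b + c

  p : ℕ → ℕ
  p = tripleMap a b c

  p-low : ∀ {x} → x ≤ a → p x ≡ suc n ∸ x
  p-low {x} x≤a with x ≤? a
  ... | yes _ = refl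
  ... | no x≰a = ⊥-elim (x≰a x≤a)

  p-mid : ∀ {x} → a < x → x ≤ a + b → p x ≡ suc (a + b) ∸ x
  p-mid {x} a<x x≤a+b with x ≤? a
  ... | yes x≤a = ⊥-elim (<⇒≱ a<x x≤a)
  ... | no _ with x ≤? a + b
  ...   | yes _ = refl
  ...   | no x≰a+b = ⊥-elim (x≰a+b x≤a+b)

  p-high : ∀ {x} → a + b < x → p x ≡ suc (n + b) ∸ x
  p-high {x} a+b<x with x ≤? a
  ... | yes x≤a = ⊥-elim (<⇒≱ a+b<x (≤-trans x≤a (m≤m+n a b)))
  ... | no _ with x ≤? a + b
  ...   | yes x≤a+b = ⊥-elim (<⇒≱ a+b<x x≤a+b)
  ...   | no _ = refl

  mid-offset : ∀ {x} → a < x → suc (a + b) ∸ x ≤ b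
  mid-offset a<x = ≤-trans (∸-monoʳ-≤ (suc (a + b)) a<x) (≤-reflexive (m+n∸m≡n a b))

  high-split : ∀ {x} → x ≤ n → suc (n + b) ∸ x ≡ (suc n ∸ x) + b
  high-split x≤n = +-∸-comm b (m≤n⇒m≤1+n x≤n)

  high-offset : ∀ {x} → a + b < x → suc n ∸ x ≤ c
  high-offset a+b<x = ≤-trans (∸-monoʳ-≤ (suc n) a+b<x) (≤-reflexive (m+n∸m≡n (a + b) c))

  p-range : ∀ x → InRange n x → InRange n (p x)
  p-range x (1≤x , x≤n) with ≤-<-connex x a
  ... | inj₁ x≤a rewrite p-low x≤a = reflect-pos x≤n , reflect-≤ n 1≤x
  ... | inj₂ a<x with ≤-<-connex x (a + b)
  ...   | inj₁ x≤a+b rewrite p-mid a<x x≤a+b =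
    reflect-pos x≤a+b , ≤-trans (reflect-≤ (a + b) 1≤x) (m≤m+n (a + b) c)
  ...   | inj₂ a+b<x rewrite p-high a+b<x = reflect-pos (≤-trans x≤n (m≤m+n n b)) , p[x]≤n
    where
    p[x]≤n : suc (n + b) ∸ x ≤ n
    p[x]≤n = begin
      suc (n + b) ∸ x   ≡⟨ high-split x≤n ⟩
      (suc n ∸ x) + b   ≤⟨ +-monoˡ-≤ b (high-offset a+b<x) ⟩
      c + b             ≤⟨ m≤n+m (c + b) a ⟩
      a + (c + b)       ≡⟨ cong (a +_) (+-comm c b) ⟩
      a + (b + c)       ≡⟨ sym (+-assoc a b c) ⟩
      n                 ∎
      where open ≤-Reasoning

  fold : ℕ → ℕ
  fold x with x ≤? a
  ... | yes _ = x
  ... | no _  = suc n ∸ x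

  fold-low : ∀ {x} → x ≤ a → fold x ≡ x
  fold-low {x} x≤a with x ≤? a
  ... | yes _ = refl
  ... | no x≰a = ⊥-elim (x≰a x≤a)

  fold-high : ∀ {x} → a < x → fold x ≡ suc n ∸ x
  fold-high {x} a<x with x ≤? a
  ... | yes x≤a = ⊥-elim (<⇒≱ a<x x≤a)
  ... | no _ = refl

  reflect-above : a ≡ b + c → ∀ {x} → x ≤ a → a < suc n ∸ x
  reflect-above a≡b+c {x} x≤a =
    m+n≤o⇒m≤o∸n (suc a) (subst (_≤ suc n) (cong suc (+-comm x a)) (s≤s x+a≤n))
    where
    x+a≤n : x + a ≤ n
    x+a≤n = begin
      x + a        ≤⟨ +-monoˡ-≤ a x≤a ⟩
      a + a        ≡⟨ cong (a +_) a≡b+c ⟩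
      a + (b + c)  ≡⟨ sym (+-assoc a b c) ⟩
      n            ∎
      where open ≤-Reasoning

  mid-below : a ≡ b + c → ∀ {x} → a < x → suc (a + b) ∸ x ≤ a
  mid-below a≡b+c a<x = ≤-trans (mid-offset a<x) (subst (b ≤_) (sym a≡b+c) (m≤m+n b c))

  high-below : a ≡ b + c → ∀ {x} → x ≤ n → a + b < x → suc (n + b) ∸ x ≤ a
  high-below a≡b+c {x} x≤n a+b<x = begin
    suc (n + b) ∸ x   ≡⟨ high-split x≤n ⟩
    (suc n ∸ x) + b   ≤⟨ +-monoˡ-≤ b (high-offset a+b<x) ⟩
    c + b             ≡⟨ +-comm c b ⟩
    b + c             ≡⟨ sym a≡b+c ⟩
    a                 ∎
    where open ≤-Reasoning

  fold-shift : a ≡ b + c → ∀ x → x ≤ n →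
               fold (p x) ≡ fold x ⊎ fold x ≡ fold (p x) + c ⊎ fold (p x) ≡ fold x + b
  fold-shift a≡b+c x x≤n with ≤-<-connex x a
  ... | inj₁ x≤a = inj₁ (begin
      fold (p x)            ≡⟨ cong fold (p-low x≤a) ⟩
      fold (suc n ∸ x)      ≡⟨ fold-high (reflect-above a≡b+c x≤a) ⟩
      suc n ∸ (suc n ∸ x)   ≡⟨ m∸[m∸n]≡n (m≤n⇒m≤1+n x≤n) ⟩
      x                     ≡⟨ sym (fold-low x≤a) ⟩
      fold x                ∎)
    where open ≡-Reasoning
  ... | inj₂ a<x with ≤-<-connex x (a + b)
  ...   | inj₁ x≤a+b = inj₂ (inj₁ (begin
      fold x                  ≡⟨ fold-high a<x ⟩
      suc (a + b) + c ∸ x     ≡⟨ +-∸-comm c (m≤n⇒m≤1+n x≤a+b) ⟩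
      (suc (a + b) ∸ x) + c   ≡⟨ cong (_+ c) (sym (fold-low (mid-below a≡b+c a<x))) ⟩
      fold (suc (a + b) ∸ x) + c ≡⟨ cong (λ y → fold y + c) (sym (p-mid a<x x≤a+b)) ⟩
      fold (p x) + c          ∎))
    where open ≡-Reasoning
  ...   | inj₂ a+b<x = inj₂ (inj₂ (begin
      fold (p x)              ≡⟨ cong fold (p-high a+b<x) ⟩
      fold (suc (n + b) ∸ x)  ≡⟨ fold-low (high-below a≡b+c x≤n a+b<x) ⟩
      suc (n + b) ∸ x         ≡⟨ high-split x≤n ⟩
      (suc n ∸ x) + b         ≡⟨ cong (_+ b) (sym (fold-high a<x)) ⟩
      fold x + b              ∎))
    where open ≡-Reasoning

  fold-mod-step : a ≡ b + c → ∀ d .{{_ : NonZero d}} → d ∣ b → d ∣ c →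
                       ∀ x → x ≤ n → fold (p x) % d ≡ fold x % d
  fold-mod-step a≡b+c d (divides qb refl) (divides qc refl) x x≤n
    with fold-shift a≡b+c x x≤n
  ... | inj₁ same = cong (_% d) same
  ... | inj₂ (inj₁ down) = sym (trans (cong (_% d) down) ([m+kn]%n≡m%n (fold (p x)) qc d))
  ... | inj₂ (inj₂ up) = trans (cong (_% d) up) ([m+kn]%n≡m%n (fold x) qb d)

  -- Along the orbit of any point of [n], the folded position modulo d is
  -- constant (the orbit stays in [n], where the single step applies).
  fold-mod-orbit : a ≡ b + c → ∀ d .{{_ : NonZero d}} → d ∣ b → d ∣ c →
                   ∀ k x → InRange n x → fold (iter p k x) % d ≡ fold x % d
  fold-mod-orbit a≡b+c d d∣b d∣c k x x∈[n] =
    proj₂ (iter-preserves p step k x (x∈[n] , refl))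
    where
    Invariant : ℕ → Set
    Invariant y = InRange n y × fold y % d ≡ fold x % d
    step : ∀ y → Invariant y → Invariant (p y)
    step y (y∈[n] , r) =
      p-range y y∈[n] , trans (fold-mod-step a≡b+c d d∣b d∣c y (proj₂ y∈[n])) r

residues-2-1 : ∀ d .{{_ : NonZero d}} → 2 % d ≡ 1 % d → d ≡ 1
residues-2-1 (suc zero) _ = refl
residues-2-1 (suc (suc zero)) ()
residues-2-1 (suc (suc (suc d))) ()

proposition7 : ∀ a b c → 1 ≤ a → 1 ≤ b → 1 ≤ c →
    Good a b c → a ≡ b + c → Coprime b c
proposition7 a b c _ 1≤b 1≤c good a≡b+c {zero} (0∣b , _) =
  ⊥-elim (<⇒≢ 1≤b (sym (0∣⇒≡0 0∣b)))
proposition7 a b c _ 1≤b 1≤c good a≡b+c {d@(suc _)} (d∣b , d∣c) =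
  residues-2-1 d (begin
    2 % d                  ≡⟨ cong (_% d) (sym (fold-low 2≤a)) ⟩
    fold 2 % d             ≡⟨ cong (λ y → fold y % d) (sym 1↦2) ⟩
    fold (iter p k 1) % d  ≡⟨ fold-mod-orbit a≡b+c d d∣b d∣c k 1 (≤-refl , 1≤n) ⟩
    fold 1 % d             ≡⟨ cong (_% d) (fold-low 1≤a) ⟩
    1 % d                  ∎)
  where
  open Triple a b c
  open ≡-Reasoning
  2≤a : 2 ≤ a
  2≤a = subst (2 ≤_) (sym a≡b+c) (+-mono-≤ 1≤b 1≤c)
  1≤a : 1 ≤ a
  1≤a = ≤-trans (s≤s z≤n) 2≤a
  a≤n : a ≤ n
  a≤n = ≤-trans (m≤m+n a b) (m≤m+n (a + b) c)
  1≤n : 1 ≤ n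
  1≤n = ≤-trans 1≤a a≤n
  orbit : ∃ λ k → iter p k 1 ≡ 2
  orbit = good 1 2 ≤-refl 1≤n (s≤s z≤n) (≤-trans 2≤a a≤n)
  k : ℕ
  k = proj₁ orbit
  1↦2 : iter p k 1 ≡ 2
  1↦2 = proj₂ orbit
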